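{- Let $k,n$ be positive integers, $m=(n-1)k+1$, let $\mathcal{I}\subseteq\Pi_m$ be the set of partitions of $\{1,\dots,m\}$ with exactly one block of size larger than $1$, and let $\mathcal{G}=\{x\in\mathcal{I}\mid \mathrm{rk}(x)\equiv0\pmod k\}\subseteq\Pi^{(k)}_m$. Then: (a) For all $x\in\Pi^{(k)}_m$, $F(x)=\max\mathcal{G}_{\le x}$, where $F(x)=\max \mathcal{I}_{\le x}$ (maximal elements of $\mathcal{I}$ below $x$ in $\Pi_m$). (b) Let $a,b\in\mathcal{G}$ and let $A,B$ denote the non-singleton blocks of $a$ and $b$, respectively. Then $A\cap B=\emptyset$ if and only if $a$ and $b$ have a unique minimal upper bound in $\Pi^{(k)}_m$ and this minimal upper bound is not an element of $\mathcal{G}$.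
   Context: $\Pi_m$ is the lattice of set partitions of $\{1,\dots,m\}$ ordered by refinement; $\mathrm{rk}(x)=m-(\text{number of blocks of }x)$. $\Pi^{(k)}_m$ is the subposet of $\Pi_m$ consisting of partitions all of whose blocks have size congruent to $1$ modulo $k$, with the induced order; it is in general not a lattice, and for $a,b\in\Pi^{(k)}_m$ one considers the set of minimal upper bounds of $\{a,b\}$ in $\Pi^{(k)}_m$. For a subset $S$ of a poset, $\max S$ denotes its set of maximal elements, and $\mathcal{G}_{\le x}=\{g\in\mathcal{G}\mid g\le x\}$. -}

module Defs where

open import Data.Nat using (ℕ; zero; suc; _+_; _*_; _∸_; _<_; _≤_; NonZero; _<ᵇ_; _≡ᵇ_)
open import Data.Nat.DivMod using (_%_)
open import Data.Fin using (Fin; toℕ)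
import Data.Fin as F
open import Data.Bool using (Bool; true; false; T; not; if_then_else_; _∧_)
open import Data.Product using (Σ; _×_; ∃; _,_)
open import Relation.Nullary using (¬_)
open import Relation.Binary.PropositionalEquality using (_≡_)

-- Set partitions of Fin m (= {1,…,m}), given by their (decidable)
-- equivalence relation "i and j lie in the same block".
record Partition (m : ℕ) : Set where
  field
    rel     : Fin m → Fin m → Bool
    reflexive  : ∀ i → T (rel i i)
    symmetric  : ∀ i j → T (rel i j) → T (rel j i)
    transitive : ∀ i j l → T (rel i j) → T (rel j l) → T (rel i l)
open Partition public

_⊑_ : ∀ {m} → Partition m → Partition m → Set
x ⊑ y = ∀ i j → T (rel x i j) → T (rel y i j)

_≈_ : ∀ {m} → Partition m → Partition m → Set
x ≈ y = x ⊑ y × y ⊑ x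

count : ∀ {m} → (Fin m → Bool) → ℕ
count {zero}  p = 0
count {suc m} p = (if p F.zero then 1 else 0) + count (λ i → p (F.suc i))

blockSize : ∀ {m} → Partition m → Fin m → ℕ
blockSize x i = count (rel x i)

-- i is the least element of its block
isLeader : ∀ {m} → Partition m → Fin m → Bool
isLeader x i = count (λ j → (toℕ j <ᵇ toℕ i) ∧ rel x i j) ≡ᵇ 0

numBlocks : ∀ {m} → Partition m → ℕ
numBlocks x = count (isLeader x)

rk : ∀ {m} → Partition m → ℕ
rk {m} x = m ∸ numBlocks x

InPk : ∀ {m} (k : ℕ) .{{_ : NonZero k}} → Partition m → Set
InPk {m} k x = ∀ i → blockSize x i % k ≡ 1 % k

InI : ∀ {m} → Partition m → Set
InI x = (∃ λ i → 1 < blockSize x i)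
      × (∀ i j → 1 < blockSize x i → 1 < blockSize x j → T (rel x i j))

InG : ∀ {m} (k : ℕ) .{{_ : NonZero k}} → Partition m → Set
InG k x = InI x × rk x % k ≡ 0

IsMaxOf : ∀ {m} → (Partition m → Set) → Partition m → Set
IsMaxOf P y = P y × (∀ z → P z → y ⊑ z → z ⊑ y)

IsMinUB : ∀ {m} (k : ℕ) .{{_ : NonZero k}} → Partition m → Partition m → Partition m → Set
IsMinUB k a b u =
  InPk k u × a ⊑ u × b ⊑ u
  × (∀ v → InPk k v → a ⊑ v → b ⊑ v → v ⊑ u → u ⊑ v)

UniqueMinUBNotInG : ∀ {m} (k : ℕ) .{{_ : NonZero k}} → Partition m → Partition m → Set
UniqueMinUBNotInG k a b =
  ∃ λ u → IsMinUB k a b u × (∀ v → IsMinUB k a b v → v ≈ u) × ¬ InG k u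

NonSingletonBlocksDisjoint : ∀ {m} → Partition m → Partition m → Set
NonSingletonBlocksDisjoint a b = ¬ (∃ λ i → 1 < blockSize a i × 1 < blockSize b i)

{-# OPTIONS --safe #-}
module Submission where

-- A partition in 𝓘 with non-singleton block B has m − |B| + 1 blocks, so its rank is |B| − 1;
-- hence it lies in 𝓖 iff |B| ≡ 1 (mod k), and every partition of 𝓖 lies in Π^(k)_m.
-- (a) Every y ∈ 𝓘 below x lies below the partition keeping only the block of x containing the
-- non-singleton block of y, and that partition is in 𝓖 when x ∈ Π^(k)_m; so 𝓖_{≤x} is cofinal
-- in 𝓘_{≤x}, and the two sets have the same maximal elements.
-- (b) If A ∩ B = ∅, the partition with blocks A, B and singletons is in Π^(k)_m and below every
-- upper bound of a and b, hence their unique minimal upper bound; it has two non-singleton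
-- blocks, so it is not in 𝓖. If i ∈ A ∩ B and u is a minimal upper bound, then keeping only the
-- block of u containing i gives an upper bound in 𝓖 below u, which must then be u itself,
-- so u ∈ 𝓖.

open import Defs
open import Data.Nat using (ℕ; _*_; _+_; _∸_; _≤_; NonZero)
open import Data.Product using (_×_)
open import Function.Bundles using (_⇔_)

open import Data.Bool using (Bool; true; false; T; not; _∧_)
open import Data.Bool.Properties using (T-∧)
open import Data.Empty using (⊥-elim)
open import Data.Fin as Fin using (Fin; toℕ)
open import Data.Fin.Induction using (<-wellFounded)
import Data.Fin.Properties as Finₚ
open import Data.Nat using (zero; suc; _<_; z≤n; s≤s)
open import Data.Nat.DivMod using (_%_; %-remove-+ʳ; [m+n]%n≡m%n; %-distribˡ-+; n%n≡0)
open import Data.Nat.Divisibility using (m%n≡0⇒n∣m)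
open import Data.Nat.Properties
open import Data.Product using (∃; _,_; proj₁; proj₂)
open import Data.Sum using (_⊎_; inj₁; inj₂)
open import Data.Unit using (tt)
open import Function.Base using (case_of_)
open import Function.Bundles using (Equivalence; mk⇔)
open import Induction.WellFounded using (Acc; acc)
open import Relation.Nullary using (¬_; Dec; yes; no; contradiction)
open import Relation.Nullary.Decidable using (⌊_⌋; T?; decidable-stable; toWitness; fromWitness; _×-dec_; _⊎-dec_)
open import Relation.Binary.PropositionalEquality using (_≡_; refl; sym; trans; cong; cong₂; subst; module ≡-Reasoning)

open Equivalence using (to; from)

private variable
  m : ℕ

T-not⇒¬T : ∀ {b} → T (not b) → ¬ T b
T-not⇒¬T {false} _ ()

count-mono : {f g : Fin m → Bool} → (∀ j → T (f j) → T (g j)) → count f ≤ count g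
count-mono {zero}  _   = z≤n
count-mono {suc m} {f} {g} f⊆g with f Fin.zero | g Fin.zero | f⊆g Fin.zero
... | true  | true  | _      = s≤s (count-mono (λ j → f⊆g (Fin.suc j)))
... | true  | false | f₀⇒g₀ = ⊥-elim (f₀⇒g₀ tt)
... | false | true  | _      = m≤n⇒m≤1+n (count-mono (λ j → f⊆g (Fin.suc j)))
... | false | false | _      = count-mono (λ j → f⊆g (Fin.suc j))

count-cong : {f g : Fin m → Bool} → (∀ j → T (f j) → T (g j)) → (∀ j → T (g j) → T (f j)) →
             count f ≡ count g
count-cong f⊆g g⊆f = ≤-antisym (count-mono f⊆g) (count-mono g⊆f)

count≡0 : {f : Fin m → Bool} → (∀ j → ¬ T (f j)) → count f ≡ 0
count≡0 {zero}      _    = refl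
count≡0 {suc m} {f} none with f Fin.zero | none Fin.zero
... | true  | ¬f₀ = ⊥-elim (¬f₀ tt)
... | false | _   = count≡0 (λ j → none (Fin.suc j))

count>0 : {f : Fin m → Bool} (i : Fin m) → T (f i) → 0 < count f
count>0 {suc m} {f} Fin.zero fi with f Fin.zero
... | true = s≤s z≤n
count>0 {suc m} {f} (Fin.suc i) fi with f Fin.zero
... | true  = s≤s z≤n
... | false = count>0 i fi

count>0⇒∃ : {f : Fin m → Bool} → 0 < count f → ∃ λ j → T (f j)
count>0⇒∃ {suc m} {f} pos with f Fin.zero in f₀≡
... | true  = Fin.zero , subst T (sym f₀≡) tt
... | false = let (j , fj) = count>0⇒∃ pos in Fin.suc j , fj

count-tail : (f : Fin (suc m) → Bool) → count (λ j → f (Fin.suc j)) ≤ count f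
count-tail f with f Fin.zero
... | true  = n≤1+n _
... | false = ≤-refl

count≥2 : {f : Fin m → Bool} (i j : Fin m) → T (f i) → T (f j) → ¬ i ≡ j → 2 ≤ count f
count≥2 {suc m} {f} Fin.zero Fin.zero _ _ i≢j = contradiction refl i≢j
count≥2 {suc m} {f} Fin.zero (Fin.suc j) f₀ fj _ with f Fin.zero
... | true = s≤s (count>0 j fj)
count≥2 {suc m} {f} (Fin.suc i) Fin.zero fi f₀ _ with f Fin.zero
... | true = s≤s (count>0 i fi)
count≥2 {suc m} {f} (Fin.suc i) (Fin.suc j) fi fj i≢j =
  ≤-trans (count≥2 i j fi fj (λ i≡j → i≢j (cong Fin.suc i≡j))) (count-tail f)

count≡1 : {f : Fin m → Bool} (i : Fin m) → T (f i) → (∀ j → T (f j) → j ≡ i) → count f ≡ 1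
count≡1 {suc m} {f} Fin.zero fi only with f Fin.zero
... | true = cong suc (count≡0 (λ j fj → Finₚ.0≢1+n (sym (only (Fin.suc j) fj))))
count≡1 {suc m} {f} (Fin.suc i) fi only with f Fin.zero in f₀≡
... | true  = contradiction (only Fin.zero (subst T (sym f₀≡) tt)) Finₚ.0≢1+n
... | false = count≡1 i fi (λ j fj → Finₚ.suc-injective (only (Fin.suc j) fj))

count-true : ∀ m → count {m} (λ _ → true) ≡ m
count-true zero    = refl
count-true (suc m) = cong suc (count-true m)

count≤ : (f : Fin m → Bool) → count f ≤ m
count≤ {m} f =
  ≤-trans (count-mono {f = f} {g = λ _ → true} (λ _ _ → tt)) (≤-reflexive (count-true m))

count-split : (f g : Fin m → Bool) →
              count f ≡ count (λ j → f j ∧ g j) + count (λ j → f j ∧ not (g j))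
count-split {zero}  f g = refl
count-split {suc m} f g
  with f Fin.zero | g Fin.zero | count-split (λ j → f (Fin.suc j)) (λ j → g (Fin.suc j))
... | true  | true  | rest = cong suc rest
... | true  | false | rest = trans (cong suc rest) (sym (+-suc _ _))
... | false | true  | rest = rest
... | false | false | rest = rest

%≡0⇔1+%≡1% : ∀ k .{{_ : NonZero k}} t → t % k ≡ 0 ⇔ suc t % k ≡ 1 % k
%≡0⇔1+%≡1% k t = mk⇔ (λ t%k≡0 → %-remove-+ʳ 1 (m%n≡0⇒n∣m t k t%k≡0)) (cancel k)
  where
  open ≡-Reasoning
  cancel : ∀ k .{{_ : NonZero k}} → suc t % k ≡ 1 % k → t % k ≡ 0
  cancel k@(suc k′) eq = begin
    t % k                    ≡⟨ [m+n]%n≡m%n t k ⟨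
    (t + k) % k              ≡⟨ cong (_% k) (+-suc t k′) ⟩
    (suc t + k′) % k         ≡⟨ %-distribˡ-+ (suc t) k′ k ⟩
    (suc t % k + k′ % k) % k ≡⟨ cong (λ r → (r + k′ % k) % k) eq ⟩
    (1 % k + k′ % k) % k     ≡⟨ %-distribˡ-+ 1 k′ k ⟨
    k % k                    ≡⟨ n%n≡0 k ⟩
    0                        ∎

private variable
  i j c l l′ : Fin m
  x y z : Partition m
  S S′ : Fin m → Bool

block : Partition m → Fin m → Fin m → Bool
block = rel

rel-sym : (x : Partition m) → T (rel x i j) → T (rel x j i)
rel-sym x = symmetric x _ _

rel-trans : (x : Partition m) → T (rel x i j) → T (rel x j l) → T (rel x i l)
rel-trans x = transitive x _ _ _

⊑-trans : x ⊑ y → y ⊑ z → x ⊑ z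
⊑-trans x⊑y y⊑z i j r = y⊑z i j (x⊑y i j r)

blockSize-pos : (x : Partition m) (i : Fin m) → 0 < blockSize x i
blockSize-pos x i = count>0 i (reflexive x i)

blockSize-mono : (x y : Partition m) → x ⊑ y → ∀ i → blockSize x i ≤ blockSize y i
blockSize-mono x y x⊑y i = count-mono (x⊑y i)

blockSize-cong : (x : Partition m) → T (rel x c i) → blockSize x c ≡ blockSize x i
blockSize-cong {c = c} {i = i} x ci =
  count-cong {f = rel x c} {g = rel x i} (λ j → rel-trans x (rel-sym x ci)) (λ j → rel-trans x ci)

singleton-rel : (x : Partition m) → blockSize x i ≤ 1 → T (rel x i j) → i ≡ j
singleton-rel {i = i} {j} x small r with i Fin.≟ j
... | yes i≡j = i≡j
... | no  i≢j = contradiction small (<⇒≱ (count≥2 i j (reflexive x i) r i≢j))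

Within : Partition m → (Fin m → Bool) → Set
Within v S = ∀ i j → T (S i) → T (S j) → T (rel v i j)

Within-block : (x : Partition m) (c : Fin m) → Within x (block x c)
Within-block x c i j ci cj = rel-trans x (rel-sym x ci) cj

Within-⊑ : (x y : Partition m) → x ⊑ y → Within x S → Within y S
Within-⊑ x y x⊑y within i j si sj = x⊑y i j (within i j si sj)

Within-⊆ : (w : Partition m) → (∀ j → T (S j) → T (S′ j)) → Within w S′ → Within w S
Within-⊆ w S⊆S′ within i j si sj = within i j (S⊆S′ i si) (S⊆S′ j sj)

InI-related : (x : Partition m) → InI x → 1 < blockSize x c → T (rel x i j) →
              i ≡ j ⊎ (T (rel x c i) × T (rel x c j))
InI-related {c = c} {i} x (_ , unique) big r with blockSize x i ≤? 1
... | yes small = inj₁ (singleton-rel x small r)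
... | no  large = let ci = unique c i big (≰⇒> large) in inj₂ (ci , rel-trans x ci r)

InI-⊑ : (y v : Partition m) → InI y → 1 < blockSize y c → Within v (block y c) → y ⊑ v
InI-⊑ y v iy big within i j r with InI-related y iy big r
... | inj₁ refl       = reflexive v i
... | inj₂ (ci , cj) = within i j ci cj

InI-outside : (x : Partition m) → InI x → 1 < blockSize x c → ¬ T (rel x c j) → blockSize x j ≤ 1
InI-outside {c = c} {j} x (_ , unique) big ¬cj = ≮⇒≥ (λ large → ¬cj (unique c j big large))

InI-resp-≈ : (x y : Partition m) → x ≈ y → InI x → InI y
InI-resp-≈ x y (x⊑y , y⊑x) ((c , big) , unique) =
  (c , <-≤-trans big (blockSize-mono x y x⊑y c)) ,
  λ i j bigᵢ bigⱼ → x⊑y i j (unique i j (<-≤-trans bigᵢ (blockSize-mono y x y⊑x i))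
                                        (<-≤-trans bigⱼ (blockSize-mono y x y⊑x j)))

leader-minimal : (x : Partition m) → T (isLeader x l) → T (rel x l j) → toℕ l ≤ toℕ j
leader-minimal {j = j} x isL r =
  ≮⇒≥ (λ j<l → <⇒≢ (count>0 j (T-∧ .from (<⇒<ᵇ j<l , r))) (sym (≡ᵇ⇒≡ _ 0 isL)))

leader-intro : (x : Partition m) → (∀ j → T (rel x l j) → toℕ l ≤ toℕ j) → T (isLeader x l)
leader-intro x minimal = ≡⇒≡ᵇ _ 0 (count≡0 λ j t →
  let (j<l , r) = T-∧ .to t in <⇒≱ (<ᵇ⇒< _ _ j<l) (minimal j r))

¬leader⇒smaller : (x : Partition m) → ¬ T (isLeader x l) → ∃ λ j → toℕ j < toℕ l × T (rel x l j)
¬leader⇒smaller x ¬isL =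
  let (j , t) = count>0⇒∃ (n≢0⇒n>0 (λ none → ¬isL (≡⇒≡ᵇ _ 0 none)))
      (j<l , r) = T-∧ .to t
  in j , <ᵇ⇒< _ _ j<l , r

leader-exists : (x : Partition m) (i : Fin m) → ∃ λ l → T (rel x i l) × T (isLeader x l)
leader-exists x i = go i (<-wellFounded i)
  where
  go : ∀ i → Acc Fin._<_ i → ∃ λ l → T (rel x i l) × T (isLeader x l)
  go i (acc smaller) with T? (isLeader x i)
  ... | yes isL = i , reflexive x i , isL
  ... | no  ¬isL =
    let (j , j<i , ij) = ¬leader⇒smaller x ¬isL
        (l , jl , isL) = go j (smaller j<i)
    in l , rel-trans x ij jl , isL

leader-unique : (x : Partition m) → T (rel x l l′) → T (isLeader x l) → T (isLeader x l′) → l ≡ l′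
leader-unique x r isL isL′ =
  Finₚ.toℕ-injective (≤-antisym (leader-minimal x isL r) (leader-minimal x isL′ (rel-sym x r)))

singleton-isLeader : (x : Partition m) → blockSize x i ≤ 1 → T (isLeader x i)
singleton-isLeader x small =
  leader-intro x (λ j r → ≤-reflexive (cong toℕ (singleton-rel x small r)))

isLeader-antitone : (x y : Partition m) → x ⊑ y → T (isLeader y l) → T (isLeader x l)
isLeader-antitone {l = l} x y x⊑y isL = leader-intro x (λ j r → leader-minimal y isL (x⊑y l j r))

rk-resp-≈ : (x y : Partition m) → x ≈ y → rk x ≡ rk y
rk-resp-≈ x y (x⊑y , y⊑x) =
  cong (_ ∸_) (count-cong (λ l → isLeader-antitone {l = l} y x y⊑x)
                          (λ l → isLeader-antitone {l = l} x y x⊑y))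

numBlocks+blockSize≡1+m : (x : Partition m) → InI x → 1 < blockSize x c →
                          numBlocks x + blockSize x c ≡ suc m
numBlocks+blockSize≡1+m {m = m} {c = c} x ix big = begin
  numBlocks x + blockSize x c
    ≡⟨ cong (_+ blockSize x c) (count-split (isLeader x) (block x c)) ⟩
  count (λ j → isLeader x j ∧ rel x c j) + count (λ j → isLeader x j ∧ not (rel x c j))
    + blockSize x c
    ≡⟨ cong₂ (λ p q → p + q + blockSize x c) leaders-inside leaders-outside ⟩
  suc (count (λ j → not (rel x c j)) + blockSize x c)
    ≡⟨ cong suc (+-comm _ (blockSize x c)) ⟩
  suc (blockSize x c + count (λ j → not (rel x c j)))
    ≡⟨ cong suc (count-split (λ _ → true) (block x c)) ⟨
  suc (count {m} (λ _ → true))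
    ≡⟨ cong suc (count-true m) ⟩
  suc m ∎
  where
  open ≡-Reasoning
  leaders-inside : count (λ j → isLeader x j ∧ rel x c j) ≡ 1
  leaders-inside =
    let (l , cl , isL) = leader-exists x c in
    count≡1 l (T-∧ .from (isL , cl)) λ j t →
      let (isLⱼ , cj) = T-∧ .to t in sym (leader-unique x (rel-trans x (rel-sym x cl) cj) isL isLⱼ)
  leaders-outside : count (λ j → isLeader x j ∧ not (rel x c j)) ≡ count (λ j → not (rel x c j))
  leaders-outside = count-cong (λ j t → proj₂ (T-∧ .to t)) λ j t →
    T-∧ .from (singleton-isLeader {i = j} x (InI-outside x ix big (T-not⇒¬T t)) , t)

1+rk≡blockSize : (x : Partition m) → InI x → 1 < blockSize x c → suc (rk x) ≡ blockSize x c
1+rk≡blockSize {m = m} {c = c} x ix big = begin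
  suc (m ∸ numBlocks x)
    ≡⟨ +-∸-assoc 1 (count≤ (isLeader x)) ⟨
  suc m ∸ numBlocks x
    ≡⟨ cong (_∸ numBlocks x) (numBlocks+blockSize≡1+m x ix big) ⟨
  numBlocks x + blockSize x c ∸ numBlocks x
    ≡⟨ m+n∸m≡n (numBlocks x) (blockSize x c) ⟩
  blockSize x c ∎
  where open ≡-Reasoning

Linked : (S₁ S₂ : Fin m → Bool) → Fin m → Fin m → Set
Linked S₁ S₂ i j = i ≡ j ⊎ (T (S₁ i) × T (S₁ j)) ⊎ (T (S₂ i) × T (S₂ j))

linked? : (S₁ S₂ : Fin m → Bool) (i j : Fin m) → Dec (Linked S₁ S₂ i j)
linked? S₁ S₂ i j = i Fin.≟ j ⊎-dec (T? (S₁ i) ×-dec T? (S₁ j)) ⊎-dec (T? (S₂ i) ×-dec T? (S₂ j))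

Disjoint : (S₁ S₂ : Fin m → Bool) → Set
Disjoint {m} S₁ S₂ = ∀ (i : Fin m) → T (S₁ i) → ¬ T (S₂ i)

module _ {S₁ S₂ : Fin m → Bool} where

  Linked-sym : Linked S₁ S₂ i j → Linked S₁ S₂ j i
  Linked-sym (inj₁ refl)              = inj₁ refl
  Linked-sym (inj₂ (inj₁ (si , sj))) = inj₂ (inj₁ (sj , si))
  Linked-sym (inj₂ (inj₂ (si , sj))) = inj₂ (inj₂ (sj , si))

  Linked-trans : Disjoint S₁ S₂ → Linked S₁ S₂ i j → Linked S₁ S₂ j l → Linked S₁ S₂ i l
  Linked-trans _ (inj₁ refl) jl = jl
  Linked-trans _ ij (inj₁ refl) = ij
  Linked-trans _ (inj₂ (inj₁ (si , _))) (inj₂ (inj₁ (_ , sl))) = inj₂ (inj₁ (si , sl))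
  Linked-trans _ (inj₂ (inj₂ (si , _))) (inj₂ (inj₂ (_ , sl))) = inj₂ (inj₂ (si , sl))
  Linked-trans d (inj₂ (inj₁ (_ , s₁j))) (inj₂ (inj₂ (s₂j , _))) = contradiction s₂j (d _ s₁j)
  Linked-trans d (inj₂ (inj₂ (_ , s₂j))) (inj₂ (inj₁ (s₁j , _))) = contradiction s₂j (d _ s₁j)

withBlocks : (S₁ S₂ : Fin m → Bool) → Disjoint S₁ S₂ → Partition m
rel        (withBlocks S₁ S₂ _) i j       = ⌊ linked? S₁ S₂ i j ⌋
reflexive  (withBlocks S₁ S₂ _) i         = fromWitness (inj₁ refl)
symmetric  (withBlocks S₁ S₂ _) i j r     =
  fromWitness (Linked-sym (toWitness {a? = linked? S₁ S₂ i j} r))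
transitive (withBlocks S₁ S₂ d) i j l r r′ =
  fromWitness (Linked-trans d (toWitness {a? = linked? S₁ S₂ i j} r)
                              (toWitness {a? = linked? S₁ S₂ j l} r′))

module WithBlocks {m : ℕ} (S₁ S₂ : Fin m → Bool) (d : Disjoint S₁ S₂) where

  private
    W = withBlocks S₁ S₂ d

    related⇒Linked : T (rel W i j) → Linked S₁ S₂ i j
    related⇒Linked {i = i} {j} = toWitness {a? = linked? S₁ S₂ i j}

  Within-withBlocks₁ : Within W S₁
  Within-withBlocks₁ i j si sj = fromWitness (inj₂ (inj₁ (si , sj)))

  Within-withBlocks₂ : Within W S₂
  Within-withBlocks₂ i j si sj = fromWitness (inj₂ (inj₂ (si , sj)))

  withBlocks-⊑ : (v : Partition m) → Within v S₁ → Within v S₂ → W ⊑ v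
  withBlocks-⊑ v within₁ within₂ i j r with related⇒Linked r
  ... | inj₁ refl              = reflexive v i
  ... | inj₂ (inj₁ (si , sj)) = within₁ i j si sj
  ... | inj₂ (inj₂ (si , sj)) = within₂ i j si sj

  withBlocks-separated : T (S₁ i) → T (S₂ j) → ¬ T (rel W i j)
  withBlocks-separated s₁i s₂j r with related⇒Linked r
  ... | inj₁ refl              = d _ s₁i s₂j
  ... | inj₂ (inj₁ (_ , s₁j)) = d _ s₁j s₂j
  ... | inj₂ (inj₂ (s₂i , _)) = d _ s₁i s₂i

  blockSize-withBlocks₁ : T (S₁ i) → blockSize W i ≡ count S₁
  blockSize-withBlocks₁ {i = i} s₁i = count-cong inside (λ j → Within-withBlocks₁ i j s₁i)
    where
    inside : ∀ j → T (rel W i j) → T (S₁ j)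
    inside j r with related⇒Linked r
    ... | inj₁ refl              = s₁i
    ... | inj₂ (inj₁ (_ , s₁j)) = s₁j
    ... | inj₂ (inj₂ (s₂i , _)) = contradiction s₂i (d i s₁i)

  blockSize-withBlocks₂ : T (S₂ i) → blockSize W i ≡ count S₂
  blockSize-withBlocks₂ {i = i} s₂i = count-cong inside (λ j → Within-withBlocks₂ i j s₂i)
    where
    inside : ∀ j → T (rel W i j) → T (S₂ j)
    inside j r with related⇒Linked r
    ... | inj₁ refl              = s₂i
    ... | inj₂ (inj₁ (s₁i , _)) = contradiction s₂i (d i s₁i)
    ... | inj₂ (inj₂ (_ , s₂j)) = s₂j

  blockSize-withBlocks-outside : ¬ T (S₁ i) → ¬ T (S₂ i) → blockSize W i ≡ 1
  blockSize-withBlocks-outside {i = i} ¬s₁i ¬s₂i = count≡1 i (reflexive W i) λ j r →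
    case related⇒Linked r of λ where
      (inj₁ refl)             → refl
      (inj₂ (inj₁ (s₁i , _))) → contradiction s₁i ¬s₁i
      (inj₂ (inj₂ (s₂i , _))) → contradiction s₂i ¬s₂i

  withBlocks-InPk : (k : ℕ) .{{_ : NonZero k}} →
                    count S₁ % k ≡ 1 % k → count S₂ % k ≡ 1 % k → InPk k W
  withBlocks-InPk k size₁ size₂ i = by-cases (T? (S₁ i)) (T? (S₂ i))
    where
    by-cases : Dec (T (S₁ i)) → Dec (T (S₂ i)) → blockSize W i % k ≡ 1 % k
    by-cases (yes s₁i) _         = trans (cong (_% k) (blockSize-withBlocks₁ s₁i)) size₁
    by-cases (no _)    (yes s₂i) = trans (cong (_% k) (blockSize-withBlocks₂ s₂i)) size₂
    by-cases (no ¬s₁i) (no ¬s₂i) = cong (_% k) (blockSize-withBlocks-outside ¬s₁i ¬s₂i)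

withBlock : (Fin m → Bool) → Partition m
withBlock S = withBlocks S (λ _ → false) (λ _ _ ())

module WithBlock {m : ℕ} (S : Fin m → Bool) = WithBlocks S (λ _ → false) (λ _ _ ())

withBlock-⊑ : (v : Partition m) → Within v S → withBlock S ⊑ v
withBlock-⊑ {S = S} v within = withBlocks-⊑ v within (λ _ _ ())
  where open WithBlock S

withBlock-InI : (S : Fin m → Bool) → T (S c) → 1 < count S → InI (withBlock S)
withBlock-InI {c = c} S sc big =
  (c , subst (1 <_) (sym (blockSize-withBlocks₁ sc)) big) ,
  λ i j bigᵢ bigⱼ → Within-withBlocks₁ i j (inside bigᵢ) (inside bigⱼ)
  where
  open WithBlock S
  inside : 1 < blockSize (withBlock S) i → T (S i)
  inside {i = i} bigᵢ = decidable-stable (T? (S i)) λ ¬si →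
    <-irrefl (sym (blockSize-withBlocks-outside ¬si (λ ()))) bigᵢ

IsMaxOf-cofinal : {P Q : Partition m → Set} →
                  (∀ {z} → P z → Q z) →
                  (∀ {z w} → z ≈ w → P z → P w) →
                  (∀ {z} → Q z → ∃ λ p → P p × z ⊑ p) →
                  ∀ y → IsMaxOf Q y ⇔ IsMaxOf P y
IsMaxOf-cofinal {P = P} {Q} P⊆Q P-resp-≈ cofinal y = mk⇔ maxQ⇒maxP maxP⇒maxQ
  where
  maxQ⇒maxP : IsMaxOf Q y → IsMaxOf P y
  maxQ⇒maxP (qy , maximal) =
    let (p , pp , y⊑p) = cofinal qy in
    P-resp-≈ (maximal p (P⊆Q pp) y⊑p , y⊑p) pp , λ z pz → maximal z (P⊆Q pz)
  maxP⇒maxQ : IsMaxOf P y → IsMaxOf Q y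
  maxP⇒maxQ (py , maximal) = P⊆Q py , λ z qz y⊑z →
    let (p , pp , z⊑p) = cofinal qz in
    ⊑-trans {x = z} {p} {y} z⊑p (maximal p pp (⊑-trans {x = y} {z} {p} y⊑z z⊑p))

module _ (k : ℕ) .{{_ : NonZero k}} where

  rk%≡0⇔blockSize%≡1% : (x : Partition m) → InI x → 1 < blockSize x c →
                        rk x % k ≡ 0 ⇔ blockSize x c % k ≡ 1 % k
  rk%≡0⇔blockSize%≡1% x ix big rewrite sym (1+rk≡blockSize x ix big) = %≡0⇔1+%≡1% k (rk x)

  InG-intro : (x : Partition m) → InI x → 1 < blockSize x c → blockSize x c % k ≡ 1 % k → InG k x
  InG-intro x ix big size% = ix , rk%≡0⇔blockSize%≡1% x ix big .from size%

  InG⇒blockSize% : (x : Partition m) → InG k x → 1 < blockSize x c → blockSize x c % k ≡ 1 % k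
  InG⇒blockSize% x (ix , rk%) big = rk%≡0⇔blockSize%≡1% x ix big .to rk%

  InG⇒InPk : (x : Partition m) → InG k x → InPk k x
  InG⇒InPk x gx i with blockSize x i ≤? 1
  ... | yes small = cong (_% k) (≤-antisym small (blockSize-pos x i))
  ... | no  large = InG⇒blockSize% x gx (≰⇒> large)

  InG-resp-≈ : (x y : Partition m) → x ≈ y → InG k x → InG k y
  InG-resp-≈ x y x≈y (ix , rk%) =
    InI-resp-≈ x y x≈y ix , trans (cong (_% k) (sym (rk-resp-≈ x y x≈y))) rk%

  withBlock-InG : (S : Fin m → Bool) → T (S c) → 1 < count S → count S % k ≡ 1 % k →
                  InG k (withBlock S)
  withBlock-InG S sc big size% =
    InG-intro (withBlock S) (withBlock-InI S sc big)
      (subst (1 <_) (sym size≡) big) (trans (cong (_% k) size≡) size%)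
    where size≡ = WithBlock.blockSize-withBlocks₁ S sc

  I≤x-below-G≤x : (x y : Partition m) → InPk k x → InI y → y ⊑ x →
                  ∃ λ g → (InG k g × g ⊑ x) × y ⊑ g
  I≤x-below-G≤x x y px iy@((c , big) , _) y⊑x =
    g , (withBlock-InG (block x c) (reflexive x c) bigₓ (px c) , withBlock-⊑ x (Within-block x c)) ,
    InI-⊑ y g iy big (Within-⊆ g (y⊑x c) Within-withBlocks₁)
    where
    open WithBlock (block x c)
    g = withBlock (block x c)
    bigₓ = <-≤-trans big (blockSize-mono y x y⊑x c)

  maxI≤x⇔maxG≤x : (x : Partition m) → InPk k x → ∀ y →
                  IsMaxOf (λ g → InI g × g ⊑ x) y ⇔ IsMaxOf (λ g → InG k g × g ⊑ x) y
  maxI≤x⇔maxG≤x x px = IsMaxOf-cofinal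
    (λ (gz , z⊑x) → proj₁ gz , z⊑x)
    (λ {z} {w} z≈w (gz , z⊑x) → InG-resp-≈ z w z≈w gz , ⊑-trans {x = w} {z} {x} (proj₂ z≈w) z⊑x)
    (λ {z} (iz , z⊑x) → I≤x-below-G≤x x z px iz z⊑x)

  least-upper-bound⇒unique-minimal : (a b u : Partition m) → InPk k u → a ⊑ u → b ⊑ u →
    (∀ v → a ⊑ v → b ⊑ v → u ⊑ v) → IsMinUB k a b u × (∀ v → IsMinUB k a b v → v ≈ u)
  least-upper-bound⇒unique-minimal a b u pu a⊑u b⊑u least =
    (pu , a⊑u , b⊑u , λ v _ a⊑v b⊑v _ → least v a⊑v b⊑v) ,
    λ v (pv , a⊑v , b⊑v , minimal) → minimal u pu a⊑u b⊑u (least v a⊑v b⊑v) , least v a⊑v b⊑v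

  disjoint⇒uniqueMinUBNotInG : (a b : Partition m) → InG k a → InG k b →
                               NonSingletonBlocksDisjoint a b → UniqueMinUBNotInG k a b
  disjoint⇒uniqueMinUBNotInG a b ga@(ia@((cA , bigA) , _) , _) gb@(ib@((cB , bigB) , _) , _)
                             disjoint =
    let (minimal , unique) = least-upper-bound⇒unique-minimal a b u pu a⊑u b⊑u least
    in u , minimal , unique , u∉G
    where
    d : Disjoint (block a cA) (block b cB)
    d i ai bi =
      disjoint (i , subst (1 <_) (blockSize-cong a ai) bigA , subst (1 <_) (blockSize-cong b bi) bigB)
    open WithBlocks (block a cA) (block b cB) d
    u = withBlocks (block a cA) (block b cB) d
    pu : InPk k u
    pu = withBlocks-InPk k (InG⇒blockSize% a ga bigA) (InG⇒blockSize% b gb bigB)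
    a⊑u : a ⊑ u
    a⊑u = InI-⊑ a u ia bigA Within-withBlocks₁
    b⊑u : b ⊑ u
    b⊑u = InI-⊑ b u ib bigB Within-withBlocks₂
    least : ∀ v → a ⊑ v → b ⊑ v → u ⊑ v
    least v a⊑v b⊑v =
      withBlocks-⊑ v (Within-⊑ a v a⊑v (Within-block a cA)) (Within-⊑ b v b⊑v (Within-block b cB))
    u∉G : ¬ InG k u
    u∉G ((_ , oneBlock) , _) = withBlocks-separated (reflexive a cA) (reflexive b cB)
      (oneBlock cA cB (<-≤-trans bigA (blockSize-mono a u a⊑u cA))
                      (<-≤-trans bigB (blockSize-mono b u b⊑u cB)))

  uniqueMinUBNotInG⇒disjoint : (a b : Partition m) → InI a → InI b →
                               UniqueMinUBNotInG k a b → NonSingletonBlocksDisjoint a b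
  uniqueMinUBNotInG⇒disjoint a b ia ib (u , (pu , a⊑u , b⊑u , minimal) , _ , u∉G)
                             (i , bigA , bigB) =
    u∉G (InG-resp-≈ v u (v⊑u , u⊑v) gv)
    where
    open WithBlock (block u i)
    v = withBlock (block u i)
    gv : InG k v
    gv = withBlock-InG (block u i) (reflexive u i) (<-≤-trans bigA (blockSize-mono a u a⊑u i))
                       (pu i)
    v⊑u : v ⊑ u
    v⊑u = withBlock-⊑ u (Within-block u i)
    a⊑v : a ⊑ v
    a⊑v = InI-⊑ a v ia bigA (Within-⊆ v (a⊑u i) Within-withBlocks₁)
    b⊑v : b ⊑ v
    b⊑v = InI-⊑ b v ib bigB (Within-⊆ v (b⊑u i) Within-withBlocks₁)
    u⊑v : u ⊑ v
    u⊑v = minimal v (InG⇒InPk v gv) a⊑v b⊑v v⊑u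

mainTheorem3 : (k n : ℕ) .{{_ : NonZero k}} → 1 ≤ n →
    ((x y : Partition ((n ∸ 1) * k + 1)) → InPk k x →
       IsMaxOf (λ g → InI g × g ⊑ x) y ⇔ IsMaxOf (λ g → InG k g × g ⊑ x) y)
    × ((a b : Partition ((n ∸ 1) * k + 1)) → InG k a → InG k b →
       NonSingletonBlocksDisjoint a b ⇔ UniqueMinUBNotInG k a b)
-- Both parts hold for every m; n and 1 ≤ n only fix m = (n − 1)k + 1.
mainTheorem3 k n _ =
  (λ x y px → maxI≤x⇔maxG≤x k x px y) ,
  (λ a b ga gb → mk⇔ (disjoint⇒uniqueMinUBNotInG k a b ga gb)
                     (uniqueMinUBNotInG⇒disjoint k a b (proj₁ ga) (proj₁ gb)))
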